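{- Let $G$ be an undirected graph with nonnegative edge weights inducing a metric $d$, and let a set of service requests be given, each located at a node of $G$ and having a time window $[a, a+1]$ of unit length (with $a>0$). Fix $\gamma \ge 1$ and suppose $\mathcal{A}$ is a single-vehicle subroutine with the following guarantee: given any set $S$ of such unit-window requests, $\mathcal{A}$ trims each window in $S$ to the unique half-open interval $[m/2,(m+1)/2)$, $m$ an integer, wholly contained in it, and returns a service run (valid for the trimmed windows) whose profit is at least $\frac{1}{3\gamma}$ times the maximum profit achievable by a single service run on $S$ with the original (untrimmed) windows. Algorithm 2VEHICLE runs $\mathcal{A}$ on all requests to obtain a run $R_1$, removes the requests serviced by $R_1$, runs $\mathcal{A}$ on the remaining requests to obtain a run $R_2$, and outputs $R_1,R_2$. Then $$p(R_1)+p(R_2) \ \ge\ \frac{12\gamma-1}{36\gamma^2}\bigl(p(R_1^*)+p(R_2^*)\bigr)$$ for every pair of service runs $R_1^*,R_2^*$ servicing disjoint sets of requests; i.e., 2VEHICLE is a $\frac{36\gamma^2}{12\gamma-1}$-approximation for the Multivehicle Routing Problem with unit-time windows and 2 vehicles.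
   Context: A service run is a route of a single vehicle traveling at a fixed speed along $G$ (distances measured by $d$), which may start at any node at any time and stop anywhere (unrooted); it services a request if it is at the request's node at some time within the request's time window. The profit $p(R)$ of a run (or of a collection of runs) is the number of distinct requests it services; each request can be counted only once. The Multivehicle Routing Problem with $k$ vehicles asks for $k$ service runs servicing disjoint sets of requests maximizing total profit. Since 2VEHICLE removes the requests serviced by $R_1$ before computing $R_2$, $R_1$ and $R_2$ service disjoint sets of requests.
   Formalization: The metric d, the window starts a, the times and speed of service runs, and the parameter γ take rational values; when 2a is an integer the lower half-interval is the trimmed window. -}

module Defs where

open import Data.Nat as ℕ using (ℕ)
open import Data.Integer as ℤ using (ℤ; +_)
open import Data.Rational using (ℚ; 0ℚ; 1ℚ; _≤_; _<_; _+_; _-_; _*_; _/_; _≤ᵇ_; ceiling)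
open import Data.Fin using (Fin; _≟_)
open import Data.Bool using (Bool; true; false; _∧_; not)
open import Data.Bool.ListAction using (any)
open import Data.List using (List; []; _∷_; filterᵇ; length; allFin)
open import Data.Product using (_×_; _,_)
open import Relation.Nullary.Decidable using (isYes)
open import Relation.Binary.PropositionalEquality using (_≡_)
open import Data.Unit using (⊤)

-- A (pseudo)metric on the node set Fin N: the shortest-path metric of a graph
-- with nonnegative edge weights (every such metric arises this way: take the
-- complete graph weighted by d).
record Metric (N : ℕ) : Set where
  field
    d        : Fin N → Fin N → ℚ
    nonneg   : ∀ u v → 0ℚ ≤ d u v
    refl0    : ∀ v → d v v ≡ 0ℚ
    symm     : ∀ u v → d u v ≡ d v u
    triangle : ∀ u v w → d u w ≤ d u v + d v w

-- n requests on nodes Fin N; request j sits at node loc j with window [a j, a j + 1].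
record Requests (N n : ℕ) : Set where
  field
    loc   : Fin n → Fin N
    start : Fin n → ℚ
    start-pos : ∀ j → 0ℚ < start j

Run : ℕ → Set
Run N = List (Fin N × ℚ)

-- Feasibility: the vehicle (speed s) can go from each visit to the next one in time
-- (it may start anywhere at any time, and wait).
Valid : ∀ {N} → Metric N → ℚ → Run N → Set
Valid M s []                = ⊤
Valid M s (_ ∷ [])          = ⊤
Valid M s ((u , t) ∷ (v , t') ∷ r) =
  (Metric.d M u v ≤ s * (t' - t)) × Valid M s ((v , t') ∷ r)

Subset : ℕ → Set
Subset n = Fin n → Bool

full : ∀ {n} → Subset n
full _ = true

inB : ℚ → ℚ → ℚ → Bool
inB lo hi t = (lo ≤ᵇ t) ∧ (t ≤ᵇ hi)

serves : ∀ {N n} → Requests N n → Run N → Fin n → Bool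
serves Q R j = any (λ { (v , t) → isYes (v ≟ Requests.loc Q j)
                         ∧ inB (Requests.start Q j) (Requests.start Q j + 1ℚ) t }) R

-- trimmed window: [m/2, (m+1)/2) with m = ⌈2a⌉, the (first) half-open interval of this
-- form wholly contained in [a, a+1]
trimLo trimHi : ℚ → ℚ
trimLo a = ceiling (a + a) / 2
trimHi a = (ceiling (a + a) ℤ.+ + 1) / 2

servesTrim : ∀ {N n} → Requests N n → Run N → Fin n → Bool
servesTrim Q R j = any (λ { (v , t) → isYes (v ≟ Requests.loc Q j)
                         ∧ (trimLo (Requests.start Q j) ≤ᵇ t)
                         ∧ not (trimHi (Requests.start Q j) ≤ᵇ t) }) R

countIn : ∀ {n} → Subset n → (Fin n → Bool) → ℕ
countIn {n} S P = length (filterᵇ (λ j → S j ∧ P j) (allFin n))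

profit : ∀ {N n} → Requests N n → Subset n → Run N → ℕ
profit Q S R = countIn S (serves Q R)

profitTrim : ∀ {N n} → Requests N n → Subset n → Run N → ℕ
profitTrim Q S R = countIn S (servesTrim Q R)

remaining : ∀ {N n} → Requests N n → Run N → Subset n
remaining Q R j = not (serves Q R j)

toℚ : ℕ → ℚ
toℚ k = + k / 1

module Submission where

-- Trimmed windows lie inside the original ones, so the guarantee of A bounds the
-- profit on S of any run by 3γ times the profit of A S. Applied to R₁*, R₂* on all
-- requests and on those left by R₁, this gives for T = p(R₁*) + p(R₂*) both
-- T ≤ 6γ p(R₁) and, since the disjoint runs together lose at most p(R₁) requests when
-- those serviced by R₁ are removed, T ≤ 6γ p(R₂) + p(R₁). Adding the two with weights
-- 6γ − 1 and 6γ cancels p(R₁) and leaves (12γ − 1) T ≤ 36γ² (p(R₁) + p(R₂)).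

open import Data.Bool using (Bool; true; false; T; not; _∧_)
open import Data.Empty using (⊥-elim)
open import Data.Bool.Properties using (T-∧; T-not-≡)
import Data.Fin as Fin
open import Data.Integer as ℤ using (ℤ; +_; -[1+_])
import Data.Integer.DivMod as ℤ
import Data.Integer.Properties as ℤ
open import Data.Integer.Solver using (module +-*-Solver)
open import Data.List using (List; []; _∷_; filterᵇ; length; allFin)
open import Data.List.Relation.Unary.Any as Any using ()
open import Data.List.Relation.Unary.Any.Properties using (any⁺; any⁻)
open import Data.Nat as ℕ using (ℕ; suc)
import Data.Nat.Coprimality as Coprime
import Data.Nat.Properties as ℕ
open import Data.Product as Product using (_×_; _,_; proj₁)
open import Data.Unit using (tt)
open import Function using (_∘_)
open import Function.Bundles using (Equivalence)
open import Relation.Binary.PropositionalEquality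
  using (_≡_; refl; sym; trans; cong; cong₂; subst; subst₂)
open import Relation.Nullary.Decidable using (isYes)

open import Defs

open Equivalence using (to; from)

module Counting where
  open import Data.Nat using (_≤_; _+_; z≤n; s≤s)
  open import Algebra.Properties.CommutativeSemigroup ℕ.+-commutativeSemigroup
    using (interchange)

  private variable
    A : Set

  count : (A → Bool) → List A → ℕ
  count f = length ∘ filterᵇ f

  count-mono : (f g : A → Bool) → (∀ x → T (f x) → T (g x)) →
               ∀ xs → count f xs ≤ count g xs
  count-mono f g f⊆g [] = z≤n
  count-mono f g f⊆g (x ∷ xs) with f x | g x | f⊆g x
  ... | false | false | _      = count-mono f g f⊆g xs
  ... | false | true  | _      = ℕ.m≤n⇒m≤1+n (count-mono f g f⊆g xs)
  ... | true  | false | fx⇒gx = ⊥-elim (fx⇒gx tt)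
  ... | true  | true  | _      = s≤s (count-mono f g f⊆g xs)

  count-split : (r f : A → Bool) → ∀ xs →
                count f xs ≡ count (λ x → not (r x) ∧ f x) xs + count (λ x → r x ∧ f x) xs
  count-split r f [] = refl
  count-split r f (x ∷ xs) with r x | f x
  ... | false | false = count-split r f xs
  ... | true  | false = count-split r f xs
  ... | false | true  = cong suc (count-split r f xs)
  ... | true  | true  = trans (cong suc (count-split r f xs)) (sym (ℕ.+-suc _ _))

  count-disjoint-≤ : (f g h : A → Bool) → (∀ x → f x ∧ g x ≡ false) →
                     (∀ x → T (f x) → T (h x)) → (∀ x → T (g x) → T (h x)) →
                     ∀ xs → count f xs + count g xs ≤ count h xs
  count-disjoint-≤ f g h disj f⊆h g⊆h [] = z≤n
  count-disjoint-≤ f g h disj f⊆h g⊆h (x ∷ xs)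
    with f x | g x | h x | disj x | f⊆h x | g⊆h x | count-disjoint-≤ f g h disj f⊆h g⊆h xs
  ... | true  | true  | _     | ()  | _      | _      | _
  ... | true  | false | false | _   | fx⇒hx | _      | _  = ⊥-elim (fx⇒hx tt)
  ... | false | true  | false | _   | _      | gx⇒hx | _  = ⊥-elim (gx⇒hx tt)
  ... | true  | false | true  | _   | _      | _      | ih = s≤s ih
  ... | false | true  | true  | _   | _      | _      | ih = ℕ.≤-trans (ℕ.≤-reflexive (ℕ.+-suc _ _)) (s≤s ih)
  ... | false | false | true  | _   | _      | _      | ih = ℕ.m≤n⇒m≤1+n ih
  ... | false | false | false | _   | _      | _      | ih = ih

  count-disjoint-≤-residual : (r f g : A → Bool) → (∀ x → f x ∧ g x ≡ false) → ∀ xs →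
    count f xs + count g xs
      ≤ (count (λ x → not (r x) ∧ f x) xs + count (λ x → not (r x) ∧ g x) xs) + count r xs
  count-disjoint-≤-residual {A = A} r f g disj xs = begin
    count f xs + count g xs
      ≡⟨ cong₂ _+_ (count-split r f xs) (count-split r g xs) ⟩
    (count f̃ xs + count (r ∧̇ f) xs) + (count g̃ xs + count (r ∧̇ g) xs)
      ≡⟨ interchange (count f̃ xs) _ _ _ ⟩
    (count f̃ xs + count g̃ xs) + (count (r ∧̇ f) xs + count (r ∧̇ g) xs)
      ≤⟨ ℕ.+-monoʳ-≤ (count f̃ xs + count g̃ xs)
           (count-disjoint-≤ (r ∧̇ f) (r ∧̇ g) r disj′ (λ _ → proj₁ ∘ T-∧ .to) (λ _ → proj₁ ∘ T-∧ .to) xs) ⟩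
    (count f̃ xs + count g̃ xs) + count r xs ∎
    where
    open ℕ.≤-Reasoning
    _∧̇_ : (A → Bool) → (A → Bool) → A → Bool
    (p ∧̇ q) x = p x ∧ q x
    f̃ g̃ : A → Bool
    f̃ = (not ∘ r) ∧̇ f
    g̃ = (not ∘ r) ∧̇ g
    disj′ : ∀ x → (r x ∧ f x) ∧ (r x ∧ g x) ≡ false
    disj′ x with r x | f x | g x | disj x
    ... | false | _     | _     | _ = refl
    ... | true  | false | _     | _ = refl
    ... | true  | true  | false | _ = refl

open Counting

open import Data.Rational
open import Data.Rational.Properties
open import Data.Rational.Solver renaming (module +-*-Solver to ℚ-Solver)
import Data.Rational.Unnormalised as ℚᵘ
import Data.Rational.Unnormalised.Properties as ℚᵘ
open import Algebra.Properties.Group +-0-group using (⁻¹-involutive)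

-- _/_ normalises by a gcd computation, so i / 1 is stuck for a variable i; ι i is the
-- same rational with its numerator i and denominator 1 exposed.
private
  ι : ℤ → ℚ
  ι i = mkℚ i 0 (Coprime.sym (Coprime.1-coprimeTo ℤ.∣ i ∣))

  /1≡ι : ∀ i → i / 1 ≡ ι i
  /1≡ι i = ↥p/↧p≡p (ι i)

/1-mono-≤ : ∀ {i j} → i ℤ.≤ j → i / 1 ≤ j / 1
/1-mono-≤ {i} {j} i≤j rewrite /1≡ι i | /1≡ι j =
  *≤* (subst₂ ℤ._≤_ (sym (ℤ.*-identityʳ i)) (sym (ℤ.*-identityʳ j)) i≤j)

/1-homo-+ : ∀ i j → (i ℤ.+ j) / 1 ≡ i / 1 + j / 1
/1-homo-+ i j rewrite /1≡ι i | /1≡ι j | /1≡ι (i ℤ.+ j) =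
  toℚᵘ-injective (ℚᵘ.≃-sym (ℚᵘ.≃-trans (toℚᵘ-homo-+ (ι i) (ι j))
    (ℚᵘ.*≡* (cong (ℤ._* + 1) (cong₂ ℤ._+_ (ℤ.*-identityʳ i) (ℤ.*-identityʳ j))))))

/1-homo-neg : ∀ i → (ℤ.- i) / 1 ≡ - (i / 1)
/1-homo-neg i rewrite /1≡ι i | /1≡ι (ℤ.- i) = ι-homo-neg i
  where
  ι-homo-neg : ∀ i → ι (ℤ.- i) ≡ - ι i
  ι-homo-neg -[1+ n ]  = refl
  ι-homo-neg (+ 0)     = refl
  ι-homo-neg (+ suc n) = refl

floor-≤ : ∀ p → floor p / 1 ≤ p
floor-≤ p@(mkℚ m d-1 _) rewrite /1≡ι (floor p) =
  *≤* (subst ((m ℤ./ d) ℤ.* d ℤ.≤_) (sym (ℤ.*-identityʳ m)) (ℤ.[n/d]*d≤n m d))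
  where
  d : ℤ
  d = + suc d-1

≤-floor+1 : ∀ p → p ≤ (floor p ℤ.+ + 1) / 1
≤-floor+1 p@(mkℚ m d-1 _) rewrite /1≡ι (floor p ℤ.+ + 1) = *≤* (begin
  m ℤ.* + 1                 ≡⟨ ℤ.*-identityʳ m ⟩
  m                         ≡⟨ ℤ.a≡a%n+[a/n]*n m d ⟩
  + (m ℤ.% d) ℤ.+ q ℤ.* d   ≤⟨ ℤ.+-monoˡ-≤ (q ℤ.* d) (ℤ.+≤+ (ℕ.<⇒≤ (ℤ.n%d<d m d))) ⟩
  d ℤ.+ q ℤ.* d             ≡⟨ solve 2 (λ d q → d :+ q :* d := (q :+ con (+ 1)) :* d) refl d q ⟩
  (q ℤ.+ + 1) ℤ.* d         ∎)
  where
  open ℤ.≤-Reasoning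
  open +-*-Solver
  d q : ℤ
  d = + suc d-1
  q = m ℤ./ d

≤-ceiling : ∀ p → p ≤ ceiling p / 1
≤-ceiling p@record{} = begin
  p                       ≡⟨ sym (⁻¹-involutive p) ⟩
  - (- p)                 ≤⟨ neg-antimono-≤ (floor-≤ (- p)) ⟩
  - (floor (- p) / 1)     ≡⟨ sym (/1-homo-neg (floor (- p))) ⟩
  ceiling p / 1           ∎
  where open ≤-Reasoning

ceiling-≤ : ∀ p → ceiling p / 1 ≤ p + 1ℚ
ceiling-≤ p@record{} = begin
  ceiling p / 1           ≡⟨ /1-homo-neg f ⟩
  - (f / 1)               ≡⟨ solve 1 (λ x → :- x := (:- (x :+ con 1ℚ)) :+ con 1ℚ) refl (f / 1) ⟩
  - (f / 1 + 1ℚ) + 1ℚ     ≡⟨ cong (λ x → - x + 1ℚ) (sym (/1-homo-+ f (+ 1))) ⟩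
  - ((f ℤ.+ + 1) / 1) + 1ℚ ≤⟨ +-monoˡ-≤ 1ℚ (neg-antimono-≤ (≤-floor+1 (- p))) ⟩
  - (- p) + 1ℚ            ≡⟨ cong (_+ 1ℚ) (⁻¹-involutive p) ⟩
  p + 1ℚ                  ∎
  where
  open ≤-Reasoning
  open ℚ-Solver
  f : ℤ
  f = floor (- p)

/2≡/1*½ : ∀ i → i / 2 ≡ i / 1 * ½
/2≡/1*½ i rewrite /1≡ι i = toℚᵘ-injective (ℚᵘ.≃-trans (toℚᵘ-fromℚᵘ (ℚᵘ.mkℚᵘ i 1))
  (ℚᵘ.≃-sym (ℚᵘ.≃-trans (toℚᵘ-homo-* (ι i) ½) (ℚᵘ.*≡* (cong (ℤ._* + 2) (ℤ.*-identityʳ i))))))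

≤-trimLo : ∀ a → a ≤ trimLo a
≤-trimLo a = begin
  a                         ≡⟨ solve 1 (λ x → x := (x :+ x) :* con ½) refl a ⟩
  (a + a) * ½               ≤⟨ *-monoʳ-≤-nonNeg ½ (≤-ceiling (a + a)) ⟩
  ceiling (a + a) / 1 * ½   ≡⟨ sym (/2≡/1*½ (ceiling (a + a))) ⟩
  trimLo a                  ∎
  where
  open ≤-Reasoning
  open ℚ-Solver

trimHi-≤ : ∀ a → trimHi a ≤ a + 1ℚ
trimHi-≤ a = begin
  trimHi a                    ≡⟨ /2≡/1*½ (c ℤ.+ + 1) ⟩
  (c ℤ.+ + 1) / 1 * ½         ≡⟨ cong (_* ½) (/1-homo-+ c (+ 1)) ⟩
  (c / 1 + 1ℚ) * ½            ≤⟨ *-monoʳ-≤-nonNeg ½ (+-monoˡ-≤ 1ℚ (ceiling-≤ (a + a))) ⟩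
  ((a + a) + 1ℚ + 1ℚ) * ½     ≡⟨ solve 1 (λ x → ((x :+ x) :+ con 1ℚ :+ con 1ℚ) :* con ½ := x :+ con 1ℚ) refl a ⟩
  a + 1ℚ                      ∎
  where
  open ≤-Reasoning
  open ℚ-Solver
  c : ℤ
  c = ceiling (a + a)

toℚ-homo-+ : ∀ m n → toℚ (m ℕ.+ n) ≡ toℚ m + toℚ n
toℚ-homo-+ m n = /1-homo-+ (+ m) (+ n)

toℚ-mono-≤ : ∀ {m n} → m ℕ.≤ n → toℚ m ≤ toℚ n
toℚ-mono-≤ m≤n = /1-mono-≤ (ℤ.+≤+ m≤n)

trimmed-window-⊆ : ∀ a {t} → trimLo a ≤ t → t ≤ trimHi a → a ≤ t × t ≤ a + 1ℚ
trimmed-window-⊆ a lo≤t t≤hi = ≤-trans (≤-trimLo a) lo≤t , ≤-trans t≤hi (trimHi-≤ a)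

T-∧-monoʳ : ∀ b {x y} → (T x → T y) → T (b ∧ x) → T (b ∧ y)
T-∧-monoʳ true  x⇒y = x⇒y
T-∧-monoʳ false _   = λ ()

T-not-≤ᵇ⇒> : ∀ {p q} → T (not (p ≤ᵇ q)) → q < p
T-not-≤ᵇ⇒> p≰ᵇq = ≰⇒> (λ p≤q → subst T (T-not-≡ .to p≰ᵇq) (≤⇒≤ᵇ p≤q))

inTrim⇒inB : ∀ a t → T ((trimLo a ≤ᵇ t) ∧ not (trimHi a ≤ᵇ t)) → T (inB a (a + 1ℚ) t)
inTrim⇒inB a t h = T-∧ {a ≤ᵇ t} .from (Product.map ≤⇒≤ᵇ ≤⇒≤ᵇ a≤t≤a+1)
  where
  a≤t≤a+1 : a ≤ t × t ≤ a + 1ℚ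
  a≤t≤a+1 = let lo≤ᵇt , hi≰ᵇt = T-∧ {trimLo a ≤ᵇ t} .to h in
            trimmed-window-⊆ a (≤ᵇ⇒≤ lo≤ᵇt) (<⇒≤ (T-not-≤ᵇ⇒> hi≰ᵇt))

servesTrim⇒serves : ∀ {N n} (Q : Requests N n) R j → T (servesTrim Q R j) → T (serves Q R j)
servesTrim⇒serves Q R j h = any⁺ _ (Any.map (λ {x} → visit x) (any⁻ _ R h))
  where
  open Requests Q
  visit : ∀ ((v , t) : _ × ℚ) →
          T (isYes (v Fin.≟ loc j) ∧ (trimLo (start j) ≤ᵇ t) ∧ not (trimHi (start j) ≤ᵇ t)) →
          T (isYes (v Fin.≟ loc j) ∧ inB (start j) (start j + 1ℚ) t)
  visit (v , t) = T-∧-monoʳ (isYes (v Fin.≟ loc j)) (inTrim⇒inB (start j) t)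

profitTrim≤profit : ∀ {N n} (Q : Requests N n) S R → profitTrim Q S R ℕ.≤ profit Q S R
profitTrim≤profit {n = n} Q S R =
  count-mono _ _ (λ j → T-∧-monoʳ (S j) (servesTrim⇒serves Q R j)) (allFin n)

profit-disjoint-≤-remaining : ∀ {N n} (Q : Requests N n) (R R₁ R₂ : Run N) →
  (∀ j → serves Q R₁ j ∧ serves Q R₂ j ≡ false) →
  toℚ (profit Q full R₁) + toℚ (profit Q full R₂)
    ≤ toℚ (profit Q (remaining Q R) R₁) + toℚ (profit Q (remaining Q R) R₂) + toℚ (profit Q full R)
profit-disjoint-≤-remaining {n = n} Q R R₁ R₂ disjoint = begin
  toℚ p₁ + toℚ p₂               ≡⟨ sym (toℚ-homo-+ p₁ p₂) ⟩
  toℚ (p₁ ℕ.+ p₂)               ≤⟨ toℚ-mono-≤ (count-disjoint-≤-residual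
                                       (serves Q R) (serves Q R₁) (serves Q R₂) disjoint (allFin n)) ⟩
  toℚ (q₁ ℕ.+ q₂ ℕ.+ x)         ≡⟨ toℚ-homo-+ (q₁ ℕ.+ q₂) x ⟩
  toℚ (q₁ ℕ.+ q₂) + toℚ x       ≡⟨ cong (_+ toℚ x) (toℚ-homo-+ q₁ q₂) ⟩
  toℚ q₁ + toℚ q₂ + toℚ x       ∎
  where
  open ≤-Reasoning
  p₁ p₂ q₁ q₂ x : ℕ
  p₁ = profit Q full R₁
  p₂ = profit Q full R₂
  q₁ = profit Q (remaining Q R) R₁
  q₂ = profit Q (remaining Q R) R₂
  x = profit Q full R

p≤p*q : ∀ p .{{_ : NonNegative p}} {q} → 1ℚ ≤ q → p ≤ p * q
p≤p*q p {q} 1≤q = subst (_≤ p * q) (*-identityʳ p) (*-monoˡ-≤-nonNeg p 1≤q)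

combine-bounds : ∀ {γ T x y} → 1ℚ ≤ γ →
  T ≤ (+ 3 / 1) * γ * x + (+ 3 / 1) * γ * x →
  T ≤ (+ 3 / 1) * γ * y + (+ 3 / 1) * γ * y + x →
  ((+ 12 / 1) * γ - 1ℚ) * T ≤ (+ 36 / 1) * γ * γ * (x + y)
combine-bounds {γ} {T} {x} {y} 1≤γ T≤x T≤y+x = begin
  ((+ 12 / 1) * γ - 1ℚ) * T
    ≡⟨ solve 2 (λ g t → (con (+ 12 / 1) :* g :- con 1ℚ) :* t
                        := (con (+ 6 / 1) :* g :- con 1ℚ) :* t :+ (con (+ 6 / 1) :* g) :* t) refl γ T ⟩
  ((+ 6 / 1) * γ - 1ℚ) * T + (+ 6 / 1) * γ * T
    ≤⟨ +-mono-≤ (*-monoˡ-≤-nonNeg ((+ 6 / 1) * γ - 1ℚ) {{nonNegative 0≤6γ-1}} T≤x)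
                (*-monoˡ-≤-nonNeg ((+ 6 / 1) * γ) {{nonNegative 0≤6γ}} T≤y+x) ⟩
  ((+ 6 / 1) * γ - 1ℚ) * (k * x + k * x) + (+ 6 / 1) * γ * (k * y + k * y + x)
    ≡⟨ solve 3 (λ g x y → (con (+ 6 / 1) :* g :- con 1ℚ) :* (con (+ 3 / 1) :* g :* x :+ con (+ 3 / 1) :* g :* x)
                          :+ (con (+ 6 / 1) :* g) :* (con (+ 3 / 1) :* g :* y :+ con (+ 3 / 1) :* g :* y :+ x)
                          := con (+ 36 / 1) :* g :* g :* (x :+ y)) refl γ x y ⟩
  (+ 36 / 1) * γ * γ * (x + y) ∎
  where
  open ≤-Reasoning
  open ℚ-Solver
  k : ℚ
  k = (+ 3 / 1) * γ
  6≤6γ : + 6 / 1 ≤ (+ 6 / 1) * γ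
  6≤6γ = p≤p*q (+ 6 / 1) 1≤γ
  0≤6γ : 0ℚ ≤ (+ 6 / 1) * γ
  0≤6γ = ≤-trans (≤ᵇ⇒≤ tt) 6≤6γ
  0≤6γ-1 : 0ℚ ≤ (+ 6 / 1) * γ - 1ℚ
  0≤6γ-1 = ≤-trans (≤ᵇ⇒≤ tt) (+-monoˡ-≤ (- 1ℚ) 6≤6γ)

mainTheorem1 :
    ∀ {N n : ℕ} (M : Metric N) (Q : Requests N n) (s : ℚ) → 0ℚ < s →
    (γ : ℚ) → 1ℚ ≤ γ →
    (A : Subset n → Run N) →
    (∀ S → Valid M s (A S)) →
    (∀ S (R : Run N) → Valid M s R →
       toℚ (profit Q S R) ≤ (+ 3 / 1) * γ * toℚ (profitTrim Q S (A S))) →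
    let R₁ = A full
        R₂ = A (remaining Q R₁)
    in ∀ (R₁* R₂* : Run N) → Valid M s R₁* → Valid M s R₂* →
       (∀ j → serves Q R₁* j ∧ serves Q R₂* j ≡ false) →
       ((+ 12 / 1) * γ - 1ℚ) * (toℚ (profit Q full R₁*) + toℚ (profit Q full R₂*))
         ≤ (+ 36 / 1) * γ * γ * (toℚ (profit Q full R₁) + toℚ (profit Q (remaining Q R₁) R₂))
mainTheorem1 {n = n} M Q s _ γ 1≤γ A _ guarantee R₁* R₂* valid₁ valid₂ disjoint =
  combine-bounds 1≤γ
    (+-mono-≤ (approx full R₁* valid₁) (approx full R₂* valid₂))
    (≤-trans (profit-disjoint-≤-remaining Q (A full) R₁* R₂* disjoint)
             (+-monoˡ-≤ _ (+-mono-≤ (approx rest R₁* valid₁) (approx rest R₂* valid₂))))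
  where
  rest : Subset n
  rest = remaining Q (A full)
  0≤3γ : 0ℚ ≤ (+ 3 / 1) * γ
  0≤3γ = ≤-trans (≤ᵇ⇒≤ tt) (p≤p*q (+ 3 / 1) 1≤γ)
  approx : ∀ S R → Valid M s R → toℚ (profit Q S R) ≤ (+ 3 / 1) * γ * toℚ (profit Q S (A S))
  approx S R valid = ≤-trans (guarantee S R valid)
    (*-monoˡ-≤-nonNeg ((+ 3 / 1) * γ) {{nonNegative 0≤3γ}} (toℚ-mono-≤ (profitTrim≤profit Q S (A S))))
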